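{- Let $r>0$ be an integer. For every $a\in\mathbb{F}_q$ and every $\mathcal{S}\subseteq[r]$, $$\widehat{f^{(a)}_{\mathcal{S}}}(\chi_{\mathbf{0}})=\frac{\mathbb{1}[\mathcal{S}=\varnothing]}{q}-\gamma_a(q)\Big(\frac1q-1\Big)^{ -|\mathcal{S}|},$$ where $\chi_{\mathbf{0}}=(\chi_0,\dots,\chi_0)$ is the $|\mathcal{S}|$-tuple of trivial multiplicative characters.
   Context: $\mathbb{F}_q$ is a finite field with $q$ elements, $[r]=\{1,\dots,r\}$. Multiplicative characters of $\mathbb{F}_q$ are extended by $\chi(0):=0$; $\chi_0$ is the trivial one. $\gamma_0(q):=q^{ -1}-1$, $\gamma_a(q):=q^{ -1}$ for $a\in\mathbb{F}_q^*$. For $a\in\mathbb{F}_q$, $f^{(a)}:\mathbb{F}_q^r\to\mathbb{C}$ is $f^{(a)}(a_1,\dots,a_r)=1$ if $\sum_{k=1}^r a_k=a$ and $0$ otherwise. For $\mathcal{S}\subseteq[r]$ with elements $k_1<\dots<k_{|\mathcal{S}|}$, write $a_{\mathcal{S}}=(a_{k_1},\dots,a_{k_{|\mathcal{S}|}})$, and for $\mathcal{T}\subseteq[r]$ let $a_{(\mathcal{T})}$ be the $r$-tuple with $k$-th entry $a_k$ if $k\in\mathcal{T}$ and $0$ otherwise. Define $f^{(a)}_{\mathcal{S}}(a_{\mathcal{S}}):=\sum_{\mathcal{T}\subseteq\mathcal{S}}(-1)^{|\mathcal{S}\setminus\mathcal{T}|}f^{(a)}(a_{(\mathcal{T})})$.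 For $g:\mathbb{F}_q^t\to\mathbb{C}$, $\widehat{g}(\chi_1,\dots,\chi_t):=\frac{1}{(q-1)^t}\sum_{a_1,\dots,a_t\in\mathbb{F}_q}g(a_1,\dots,a_t)\overline{\chi_1}(a_1)\cdots\overline{\chi_t}(a_t)$ (for $t=0$, the value of $g$ at the empty tuple). $\mathbb{1}[\cdot]$ is the indicator. -}

module Defs where

open import Level using (0ℓ)
open import Algebra.Bundles using (CommutativeRing)
open import Data.Nat as ℕ using (ℕ; zero; suc)
open import Data.Fin using (Fin)
import Data.Integer
open import Data.Fin.Subset using (Subset; inside; outside; ∣_∣; _⊆_; _─_; ⊥)
open import Data.Fin.Subset.Properties using (_⊆?_)
open import Data.Vec using (Vec; []; _∷_; foldr)
open import Data.Vec.Properties using (≡-dec)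
open import Data.Bool.Properties as Bool using ()
open import Data.Rational as ℚ using (ℚ; 0ℚ; 1ℚ)
open import Data.Product using (∃; _,_)
open import Relation.Binary.PropositionalEquality using (_≡_)
open import Relation.Binary.Definitions using (Decidable)
open import Relation.Nullary using (¬_; yes; no)

record FiniteField : Set₁ where
  field
    ring : CommutativeRing 0ℓ 0ℓ
  open CommutativeRing ring public hiding (ring)
  field
    _≈?_     : Decidable _≈_
    0≉1      : ¬ (0# ≈ 1#)
    inverse  : ∀ x → ¬ (x ≈ 0#) → ∃ λ y → (x * y) ≈ 1#
    size     : ℕ
    enum     : Fin size → Carrier
    enum-surj : ∀ x → ∃ λ i → enum i ≈ x
    enum-inj  : ∀ i j → enum i ≈ enum j → i ≡ j

-- total inverse (only ever applied to nonzero arguments below)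
inv : ℚ → ℚ
inv p with p ℚ.≟ 0ℚ
... | yes _  = 0ℚ
... | no p≢0 = ℚ.1/_ p {{ℚ.≢-nonZero p≢0}}

_^_ : ℚ → ℕ → ℚ
p ^ zero  = 1ℚ
p ^ suc n = p ℚ.* (p ^ n)

sumFin : ∀ n → (Fin n → ℚ) → ℚ
sumFin zero    f = 0ℚ
sumFin (suc n) f = f Fin.zero ℚ.+ sumFin n (λ i → f (Fin.suc i))

sumSubsets : ∀ r → (Subset r → ℚ) → ℚ
sumSubsets zero    h = h []
sumSubsets (suc r) h = sumSubsets r (λ T → h (inside ∷ T)) ℚ.+ sumSubsets r (λ T → h (outside ∷ T))

module _ (F : FiniteField) where
  open FiniteField F

  qℚ : ℚ
  qℚ = Data.Integer.+ size ℚ./ 1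

  sumF : (Carrier → ℚ) → ℚ
  sumF g = sumFin size (λ i → g (enum i))

  sumFt : ∀ t → (Vec Carrier t → ℚ) → ℚ
  sumFt zero    g = g []
  sumFt (suc t) g = sumF (λ x → sumFt t (λ xs → g (x ∷ xs)))

  -- trivial multiplicative character, χ₀(0) = 0 (real valued, so conj χ₀ = χ₀)
  χ₀ : Carrier → ℚ
  χ₀ x with x ≈? 0#
  ... | yes _ = 0ℚ
  ... | no _  = 1ℚ

  prodχ₀ : ∀ {t} → Vec Carrier t → ℚ
  prodχ₀ []       = 1ℚ
  prodχ₀ (x ∷ xs) = χ₀ x ℚ.* prodχ₀ xs

  -- ĝ(χ₀,…,χ₀) = (q-1)^{-t} Σ_{a ∈ F_q^t} g(a) conj χ₀(a₁)⋯conj χ₀(a_t)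
  hatAtTrivial : ∀ t → (Vec Carrier t → ℚ) → ℚ
  hatAtTrivial t g = inv ((qℚ ℚ.- 1ℚ) ^ t) ℚ.* sumFt t (λ xs → g xs ℚ.* prodχ₀ xs)

  γ : Carrier → ℚ
  γ a with a ≈? 0#
  ... | yes _ = inv qℚ ℚ.- 1ℚ
  ... | no _  = inv qℚ

  sumVec : ∀ {r} → Vec Carrier r → Carrier
  sumVec = foldr _ _+_ 0#

  f : (a : Carrier) → ∀ {r} → Vec Carrier r → ℚ
  f a xs with sumVec xs ≈? a
  ... | yes _ = 1ℚ
  ... | no _  = 0ℚ

  -- from a_S (a |S|-tuple, entries in increasing order of S) to the r-tuple a_(S)
  embed : ∀ {r} (S : Subset r) → Vec Carrier ∣ S ∣ → Vec Carrier r
  embed []            xs       = []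
  embed (inside ∷ S)  (x ∷ xs) = x ∷ embed S xs
  embed (outside ∷ S) xs       = 0# ∷ embed S xs

  restrict : ∀ {r} (T : Subset r) → Vec Carrier r → Vec Carrier r
  restrict []            []       = []
  restrict (inside ∷ T)  (x ∷ xs) = x ∷ restrict T xs
  restrict (outside ∷ T) (x ∷ xs) = 0# ∷ restrict T xs

  fS : (a : Carrier) → ∀ {r} (S : Subset r) → Vec Carrier ∣ S ∣ → ℚ
  fS a {r} S xs = sumSubsets r term
    where
      term : Subset r → ℚ
      term T with T ⊆? S
      ... | yes _ = ((ℚ.- 1ℚ) ^ ∣ S ─ T ∣) ℚ.* f a (restrict T (embed S xs))
      ... | no _  = 0ℚ

𝟙[_≡∅] : ∀ {r} → Subset r → ℚ
𝟙[ S ≡∅] with ≡-dec Bool._≟_ S ⊥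
... | yes _ = 1ℚ
... | no _  = 0ℚ

{-# OPTIONS --safe #-}
-- Writing f⁽ᵃ⁾_S(a_S) = Σ_{T ⊆ S} μ(T, S) f⁽ᵃ⁾(a_(T)) with μ the Möbius function of the
-- subset lattice, an index outside S does not change f⁽ᵃ⁾_S, and an index k ∈ S peels off
-- as f⁽ᵃ⁾_S = f⁽ᵃ⁻ᵃᵏ⁾_{S∖k} - f⁽ᵃ⁾_{S∖k}. Hence H_S(a) = Σ_x f⁽ᵃ⁾_S(x) χ₀(x) satisfies
-- H_S(a) = Σ_{x ≠ 0} (H_{S∖k}(a - x) - H_{S∖k}(a)), and by induction on S
-- H_S(a) = 𝟙[S = ∅]/q - γ_a(q) (-q)^|S|: the term 𝟙[S = ∅]/q cancels in the difference and
-- Σ_{x ≠ 0} (γ_a - γ_{a-x}) = Σ_x (𝟙[x = a] - 𝟙[a = 0]) = q γ_a. Finally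
-- (-q)/(q - 1) = (1/q - 1)⁻¹ turns (q - 1)^{-|S|} H_S(a) into the claimed value.
module Submission where

open import Defs
open import Data.Nat using (ℕ; _<_)
open import Data.Fin.Subset using (Subset; ∣_∣)
open import Data.Rational using (ℚ; 1ℚ; _*_; _-_)
open import Relation.Binary.PropositionalEquality using (_≡_)

import Algebra.Properties.Group as GroupProperties
open import Level using (0ℓ)
open import Data.Bool.Properties as Bool using ()
open import Data.Fin using (Fin; zero; suc)
open import Data.Fin.Properties using (suc-injective; ¬Fin0)
open import Data.Fin.Subset using (inside; outside; _⊆_; _─_; ⊥)
open import Data.Fin.Subset.Properties using (_⊆?_; drop-∷-⊆; out⊆; in⊆in; ∣⊥∣≡0)
import Data.Integer as ℤ
import Data.Integer.Properties as ℤ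
import Data.Nat as ℕ
open import Data.Nat.Coprimality as Coprime using (1-coprimeTo)
open import Data.Product using (_,_; proj₁)
open import Data.Rational using (0ℚ; _+_; -_; mkℚ; _/_; 1/_; _≟_; ≢-nonZero; ↥_)
import Data.Rational.Properties as ℚ
open import Data.Vec using (Vec; []; _∷_; here)
open import Data.Vec.Properties using (≡-dec)
open import Function using (_∘_; id)
open import Relation.Binary.PropositionalEquality
  using (_≢_; refl; sym; trans; cong; cong₂; subst; module ≡-Reasoning)
open import Relation.Nullary using (¬_; yes; no; contradiction)
open import Relation.Nullary.Decidable using (dec⇒maybe)
open import Tactic.RingSolver using (solve-∀)
open import Tactic.RingSolver.Core.AlmostCommutativeRing using (AlmostCommutativeRing; fromCommutativeRing)

open ≡-Reasoning

ℚ-ring : AlmostCommutativeRing 0ℓ 0ℓ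
ℚ-ring = fromCommutativeRing ℚ.+-*-commutativeRing (λ x → dec⇒maybe (0ℚ ≟ x))

inv-unique : ∀ x y → x * y ≡ 1ℚ → inv x ≡ y
inv-unique x y xy≡1 with x ≟ 0ℚ
... | yes refl = contradiction (trans (sym xy≡1) (ℚ.*-zeroˡ y)) ℚ.1≢0
... | no x≢0 = begin
  1/ x             ≡⟨ sym (ℚ.*-identityʳ _) ⟩
  1/ x * 1ℚ        ≡⟨ cong (1/ x *_) (sym xy≡1) ⟩
  1/ x * (x * y)   ≡⟨ sym (ℚ.*-assoc (1/ x) x y) ⟩
  (1/ x * x) * y   ≡⟨ cong (_* y) (ℚ.*-inverseˡ x) ⟩
  1ℚ * y           ≡⟨ ℚ.*-identityˡ y ⟩
  y                ∎
  where instance _ = ≢-nonZero x≢0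

inv-inverseʳ : ∀ x → x ≢ 0ℚ → x * inv x ≡ 1ℚ
inv-inverseʳ x x≢0 with x ≟ 0ℚ
... | yes x≡0 = contradiction x≡0 x≢0
... | no x≢0 = ℚ.*-inverseʳ x {{≢-nonZero x≢0}}

^-distribʳ-* : ∀ x y n → (x * y) ^ n ≡ x ^ n * y ^ n
^-distribʳ-* x y ℕ.zero    = refl
^-distribʳ-* x y (ℕ.suc n) = begin
  x * y * (x * y) ^ n        ≡⟨ cong (x * y *_) (^-distribʳ-* x y n) ⟩
  x * y * (x ^ n * y ^ n)    ≡⟨ interchange x y (x ^ n) (y ^ n) ⟩
  x * x ^ n * (y * y ^ n)    ∎
  where
  interchange : ∀ a b c d → a * b * (c * d) ≡ a * c * (b * d)
  interchange = solve-∀ ℚ-ring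

1^n≡1 : ∀ n → 1ℚ ^ n ≡ 1ℚ
1^n≡1 ℕ.zero    = refl
1^n≡1 (ℕ.suc n) = trans (ℚ.*-identityˡ _) (1^n≡1 n)

inv-^ : ∀ x y n → x * y ≡ 1ℚ → inv (x ^ n) ≡ y ^ n
inv-^ x y n xy≡1 = inv-unique (x ^ n) (y ^ n) (begin
  x ^ n * y ^ n   ≡⟨ sym (^-distribʳ-* x y n) ⟩
  (x * y) ^ n     ≡⟨ cong (_^ n) xy≡1 ⟩
  1ℚ ^ n          ≡⟨ 1^n≡1 n ⟩
  1ℚ              ∎)

inv[x-1]^n*[-x]^n : ∀ x n → x ≢ 0ℚ → x - 1ℚ ≢ 0ℚ →
  inv ((x - 1ℚ) ^ n) * (- x) ^ n ≡ inv ((inv x - 1ℚ) ^ n)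
inv[x-1]^n*[-x]^n x n x≢0 x-1≢0 = begin
  inv ((x - 1ℚ) ^ n) * (- x) ^ n   ≡⟨ cong (_* (- x) ^ n) (inv-^ (x - 1ℚ) y n (inv-inverseʳ _ x-1≢0)) ⟩
  y ^ n * (- x) ^ n                ≡⟨ sym (^-distribʳ-* y (- x) n) ⟩
  (y * - x) ^ n                    ≡⟨ sym (inv-^ (inv x - 1ℚ) (y * - x) n inverse) ⟩
  inv ((inv x - 1ℚ) ^ n)           ∎
  where
  y = inv (x - 1ℚ)
  regroup : ∀ u u⁻¹ v → (u⁻¹ - 1ℚ) * (v * - u) ≡ (u - u * u⁻¹) * v
  regroup = solve-∀ ℚ-ring
  inverse : (inv x - 1ℚ) * (y * - x) ≡ 1ℚ
  inverse = begin
    (inv x - 1ℚ) * (y * - x)   ≡⟨ regroup x (inv x) y ⟩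
    (x - x * inv x) * y        ≡⟨ cong (λ z → (x - z) * y) (inv-inverseʳ x x≢0) ⟩
    (x - 1ℚ) * y               ≡⟨ inv-inverseʳ _ x-1≢0 ⟩
    1ℚ                         ∎

+n/1≡mkℚ : ∀ n → ℤ.+ n / 1 ≡ mkℚ (ℤ.+ n) 0 (Coprime.sym (1-coprimeTo n))
+n/1≡mkℚ n = ℚ.normalize-coprime (Coprime.sym (1-coprimeTo n))

+n/1-injective : ∀ m n → ℤ.+ m / 1 ≡ ℤ.+ n / 1 → m ≡ n
+n/1-injective m n eq =
  ℤ.+-injective (cong ↥_ (trans (sym (+n/1≡mkℚ m)) (trans eq (+n/1≡mkℚ n))))

+[1+n]/1≡1++n/1 : ∀ n → ℤ.+ ℕ.suc n / 1 ≡ 1ℚ + ℤ.+ n / 1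
+[1+n]/1≡1++n/1 n = sym (begin
  1ℚ + ℤ.+ n / 1                                      ≡⟨ cong (1ℚ +_) (+n/1≡mkℚ n) ⟩
  1ℚ + mkℚ (ℤ.+ n) 0 (Coprime.sym (1-coprimeTo n))   ≡⟨ ℚ./-cong (cong (ℤ._+_ ℤ.1ℤ) (ℤ.*-identityʳ (ℤ.+ n))) refl ⟩
  ℤ.+ ℕ.suc n / 1                                     ∎)

sumFin-cong : ∀ n {g h : Fin n → ℚ} → (∀ i → g i ≡ h i) → sumFin n g ≡ sumFin n h
sumFin-cong ℕ.zero    g≗h = refl
sumFin-cong (ℕ.suc n) g≗h = cong₂ _+_ (g≗h zero) (sumFin-cong n (g≗h ∘ suc))

sumFin-*ˡ : ∀ n c (g : Fin n → ℚ) → sumFin n (λ i → c * g i) ≡ c * sumFin n g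
sumFin-*ˡ ℕ.zero    c g = sym (ℚ.*-zeroʳ c)
sumFin-*ˡ (ℕ.suc n) c g = trans (cong (c * g zero +_) (sumFin-*ˡ n c (g ∘ suc)))
                                (sym (ℚ.*-distribˡ-+ c _ _))

sumFin-sub : ∀ n (g h : Fin n → ℚ) → sumFin n (λ i → g i - h i) ≡ sumFin n g - sumFin n h
sumFin-sub ℕ.zero    g h = refl
sumFin-sub (ℕ.suc n) g h = begin
  (g zero - h zero) + sumFin n (λ i → g (suc i) - h (suc i))
    ≡⟨ cong (g zero - h zero +_) (sumFin-sub n (g ∘ suc) (h ∘ suc)) ⟩
  (g zero - h zero) + (sumFin n (g ∘ suc) - sumFin n (h ∘ suc))
    ≡⟨ interchange (g zero) (h zero) _ _ ⟩
  (g zero + sumFin n (g ∘ suc)) - (h zero + sumFin n (h ∘ suc)) ∎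
  where
  interchange : ∀ a b c d → (a - b) + (c - d) ≡ (a + c) - (b + d)
  interchange = solve-∀ ℚ-ring

sumFin-const : ∀ n c → sumFin n (λ _ → c) ≡ (ℤ.+ n / 1) * c
sumFin-const ℕ.zero    c = sym (ℚ.*-zeroˡ c)
sumFin-const (ℕ.suc n) c = begin
  c + sumFin n (λ _ → c)       ≡⟨ cong (c +_) (sumFin-const n c) ⟩
  c + (ℤ.+ n / 1) * c          ≡⟨ collect c (ℤ.+ n / 1) ⟩
  (1ℚ + ℤ.+ n / 1) * c         ≡⟨ cong (_* c) (sym (+[1+n]/1≡1++n/1 n)) ⟩
  (ℤ.+ ℕ.suc n / 1) * c        ∎
  where
  collect : ∀ c m → c + m * c ≡ (1ℚ + m) * c
  collect = solve-∀ ℚ-ring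

sumFin-single : ∀ n (j : Fin n) (g : Fin n → ℚ) → (∀ i → i ≢ j → g i ≡ 0ℚ) → sumFin n g ≡ g j
sumFin-single (ℕ.suc n) zero g g≡0 = begin
  g zero + sumFin n (g ∘ suc)           ≡⟨ cong (g zero +_) (sumFin-cong n (λ i → g≡0 (suc i) λ ())) ⟩
  g zero + sumFin n (λ _ → 0ℚ)          ≡⟨ cong (g zero +_) (trans (sumFin-const n 0ℚ) (ℚ.*-zeroʳ (ℤ.+ n / 1))) ⟩
  g zero + 0ℚ                           ≡⟨ ℚ.+-identityʳ _ ⟩
  g zero                                ∎
sumFin-single (ℕ.suc n) (suc j) g g≡0 = begin
  g zero + sumFin n (g ∘ suc)           ≡⟨ cong (_+ sumFin n (g ∘ suc)) (g≡0 zero λ ()) ⟩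
  0ℚ + sumFin n (g ∘ suc)               ≡⟨ ℚ.+-identityˡ _ ⟩
  sumFin n (g ∘ suc)                    ≡⟨ sumFin-single n j (g ∘ suc) (λ i i≢j → g≡0 (suc i) (i≢j ∘ suc-injective)) ⟩
  g (suc j)                             ∎

sumSubsets-cong : ∀ r {g h : Subset r → ℚ} → (∀ T → g T ≡ h T) → sumSubsets r g ≡ sumSubsets r h
sumSubsets-cong ℕ.zero    g≗h = g≗h []
sumSubsets-cong (ℕ.suc r) g≗h =
  cong₂ _+_ (sumSubsets-cong r (g≗h ∘ (inside ∷_))) (sumSubsets-cong r (g≗h ∘ (outside ∷_)))

sumSubsets-zero : ∀ r (g : Subset r → ℚ) → (∀ T → g T ≡ 0ℚ) → sumSubsets r g ≡ 0ℚ
sumSubsets-zero ℕ.zero    g g≡0 = g≡0 []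
sumSubsets-zero (ℕ.suc r) g g≡0 =
  cong₂ _+_ (sumSubsets-zero r _ (g≡0 ∘ (inside ∷_))) (sumSubsets-zero r _ (g≡0 ∘ (outside ∷_)))

sumSubsets-neg : ∀ r (g : Subset r → ℚ) → sumSubsets r (λ T → - g T) ≡ - sumSubsets r g
sumSubsets-neg ℕ.zero    g = refl
sumSubsets-neg (ℕ.suc r) g =
  trans (cong₂ _+_ (sumSubsets-neg r (g ∘ (inside ∷_))) (sumSubsets-neg r (g ∘ (outside ∷_))))
        (sym (ℚ.neg-distrib-+ (sumSubsets r (g ∘ (inside ∷_))) (sumSubsets r (g ∘ (outside ∷_)))))

möbius : ∀ {r} → Subset r → Subset r → ℚ
möbius []            []            = 1ℚ
möbius (inside ∷ S)  (inside ∷ T)  = möbius S T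
möbius (inside ∷ S)  (outside ∷ T) = - möbius S T
möbius (outside ∷ S) (inside ∷ T)  = 0ℚ
möbius (outside ∷ S) (outside ∷ T) = möbius S T

möbius-⊆ : ∀ {r} {S T : Subset r} → T ⊆ S → möbius S T ≡ (- 1ℚ) ^ ∣ S ─ T ∣
möbius-⊆ {S = []}          {[]}          T⊆S = refl
möbius-⊆ {S = inside ∷ S}  {inside ∷ T}  T⊆S = möbius-⊆ (drop-∷-⊆ T⊆S)
möbius-⊆ {S = inside ∷ S}  {outside ∷ T} T⊆S =
  trans (cong -_ (möbius-⊆ (drop-∷-⊆ T⊆S))) (sym (-1*x≡-x _))
  where
  -1*x≡-x : ∀ x → - 1ℚ * x ≡ - x
  -1*x≡-x = solve-∀ ℚ-ring
möbius-⊆ {S = outside ∷ S} {inside ∷ T}  T⊆S = contradiction (T⊆S here) λ ()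
möbius-⊆ {S = outside ∷ S} {outside ∷ T} T⊆S = möbius-⊆ (drop-∷-⊆ T⊆S)

möbius-⊈ : ∀ {r} {S T : Subset r} → ¬ T ⊆ S → möbius S T ≡ 0ℚ
möbius-⊈ {S = []}          {[]}          T⊈S = contradiction (λ {_} → id) T⊈S
möbius-⊈ {S = inside ∷ S}  {inside ∷ T}  T⊈S = möbius-⊈ (T⊈S ∘ in⊆in)
möbius-⊈ {S = inside ∷ S}  {outside ∷ T} T⊈S = cong -_ (möbius-⊈ (T⊈S ∘ out⊆))
möbius-⊈ {S = outside ∷ S} {inside ∷ T}  T⊈S = refl
möbius-⊈ {S = outside ∷ S} {outside ∷ T} T⊈S = möbius-⊈ (T⊈S ∘ out⊆)

𝟙[outside∷S≡∅] : ∀ {r} (S : Subset r) → 𝟙[ outside ∷ S ≡∅] ≡ 𝟙[ S ≡∅]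
𝟙[outside∷S≡∅] S with ≡-dec Bool._≟_ S ⊥
... | yes _ = refl
... | no _  = refl

𝟙[S≡∅]*g∣S∣ : ∀ {r} (S : Subset r) (g : ℕ → ℚ) → g 0 ≡ 1ℚ → 𝟙[ S ≡∅] * g ∣ S ∣ ≡ 𝟙[ S ≡∅]
𝟙[S≡∅]*g∣S∣ {r} S g g0≡1 with ≡-dec Bool._≟_ S ⊥
... | yes refl = trans (cong (λ n → 1ℚ * g n) (∣⊥∣≡0 r)) (trans (ℚ.*-identityˡ (g 0)) g0≡1)
... | no _     = ℚ.*-zeroˡ (g ∣ S ∣)

n≡1⇒Fin-irrelevant : ∀ {n} → n ≡ 1 → (i j : Fin n) → i ≡ j
n≡1⇒Fin-irrelevant refl zero zero = refl

module _ (F : FiniteField) where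

  open FiniteField F
    using (Carrier; _≈_; _≈?_; 0#; 1#; size; enum; enum-surj; enum-inj; 0≉1; +-group; +-comm; +-congʳ; +-identityˡ)
    renaming (_-_ to _⊖_; reflexive to ≈-reflexive; sym to ≈-sym; trans to ≈-trans)
  open GroupProperties +-group using (x≈z//y; //-rightDividesˡ; x∙y⁻¹≈ε⇒x≈y; x≈y⇒x∙y⁻¹≈ε)

  private
    q : ℚ
    q = qℚ F

  size≢0 : size ≢ 0
  size≢0 size≡0 = ¬Fin0 (subst Fin size≡0 (proj₁ (enum-surj 0#)))

  size≢1 : size ≢ 1
  size≢1 size≡1 with enum-surj 0# | enum-surj 1#
  ... | i , i↦0 | j , j↦1 =
    0≉1 (≈-trans (≈-sym i↦0) (≈-trans (≈-reflexive (cong enum (n≡1⇒Fin-irrelevant size≡1 i j))) j↦1))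

  q≢0 : q ≢ 0ℚ
  q≢0 q≡0 = size≢0 (+n/1-injective size 0 q≡0)

  q-1≢0 : q - 1ℚ ≢ 0ℚ
  q-1≢0 q-1≡0 = size≢1 (+n/1-injective size 1 (begin
    q                ≡⟨ x≡[x-1]+1 q ⟩
    (q - 1ℚ) + 1ℚ    ≡⟨ cong (_+ 1ℚ) q-1≡0 ⟩
    0ℚ + 1ℚ          ≡⟨ ℚ.+-identityˡ 1ℚ ⟩
    1ℚ               ∎))
    where
    x≡[x-1]+1 : ∀ x → x ≡ (x - 1ℚ) + 1ℚ
    x≡[x-1]+1 = solve-∀ ℚ-ring

  q*q⁻¹≡1 : q * inv q ≡ 1ℚ
  q*q⁻¹≡1 = inv-inverseʳ q q≢0

  sumFt-cong : ∀ t {g h : Vec Carrier t → ℚ} → (∀ xs → g xs ≡ h xs) → sumFt F t g ≡ sumFt F t h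
  sumFt-cong ℕ.zero    g≗h = g≗h []
  sumFt-cong (ℕ.suc t) g≗h = sumFin-cong size (λ i → sumFt-cong t (g≗h ∘ (enum i ∷_)))

  sumFt-*ˡ : ∀ t c (g : Vec Carrier t → ℚ) → sumFt F t (λ xs → c * g xs) ≡ c * sumFt F t g
  sumFt-*ˡ ℕ.zero    c g = refl
  sumFt-*ˡ (ℕ.suc t) c g =
    trans (sumFin-cong size (λ i → sumFt-*ˡ t c (g ∘ (enum i ∷_)))) (sumFin-*ˡ size c _)

  sumFt-sub : ∀ t (g h : Vec Carrier t → ℚ) → sumFt F t (λ xs → g xs - h xs) ≡ sumFt F t g - sumFt F t h
  sumFt-sub ℕ.zero    g h = refl
  sumFt-sub (ℕ.suc t) g h =
    trans (sumFin-cong size (λ i → sumFt-sub t (g ∘ (enum i ∷_)) (h ∘ (enum i ∷_)))) (sumFin-sub size _ _)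

  -- (q - 1)ᵗ ĝ(χ₀, …, χ₀)
  χ₀-sum : ∀ t → (Vec Carrier t → ℚ) → ℚ
  χ₀-sum t g = sumFt F t (λ xs → g xs * prodχ₀ F xs)

  χ₀-sum-cong : ∀ t {g h : Vec Carrier t → ℚ} → (∀ xs → g xs ≡ h xs) → χ₀-sum t g ≡ χ₀-sum t h
  χ₀-sum-cong t g≗h = sumFt-cong t (λ xs → cong (_* prodχ₀ F xs) (g≗h xs))

  χ₀-sum-sub : ∀ t (g h : Vec Carrier t → ℚ) → χ₀-sum t (λ xs → g xs - h xs) ≡ χ₀-sum t g - χ₀-sum t h
  χ₀-sum-sub t g h = trans (sumFt-cong t (λ xs → *-distribʳ-sub (g xs) (h xs) (prodχ₀ F xs))) (sumFt-sub t _ _)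
    where
    *-distribʳ-sub : ∀ a b c → (a - b) * c ≡ a * c - b * c
    *-distribʳ-sub = solve-∀ ℚ-ring

  χ₀-sum-suc : ∀ t (g : Vec Carrier (ℕ.suc t) → ℚ) →
    χ₀-sum (ℕ.suc t) g ≡ sumF F (λ x → χ₀ F x * χ₀-sum t (g ∘ (x ∷_)))
  χ₀-sum-suc t g = sumFin-cong size λ i →
    trans (sumFt-cong t (λ xs → swap (g (enum i ∷ xs)) (χ₀ F (enum i)) (prodχ₀ F xs)))
          (sumFt-*ˡ t (χ₀ F (enum i)) _)
    where
    swap : ∀ a c p → a * (c * p) ≡ c * (a * p)
    swap = solve-∀ ℚ-ring

  δ : Carrier → Carrier → ℚ
  δ x y with x ≈? y
  ... | yes _ = 1ℚ
  ... | no _  = 0ℚ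

  δ-sym : ∀ x y → δ x y ≡ δ y x
  δ-sym x y with x ≈? y | y ≈? x
  ... | yes _   | yes _   = refl
  ... | no _    | no _    = refl
  ... | yes x≈y | no y≉x  = contradiction (≈-sym x≈y) y≉x
  ... | no x≉y  | yes y≈x = contradiction (≈-sym y≈x) x≉y

  δ-congˡ : ∀ {x y} z → x ≈ y → δ x z ≡ δ y z
  δ-congˡ {x} {y} z x≈y with x ≈? z | y ≈? z
  ... | yes _   | yes _   = refl
  ... | no _    | no _    = refl
  ... | yes x≈z | no y≉z  = contradiction (≈-trans (≈-sym x≈y) x≈z) y≉z
  ... | no x≉z  | yes y≈z = contradiction (≈-trans x≈y y≈z) x≉z

  δ[a-x,0]≡δ[x,a] : ∀ a x → δ (a ⊖ x) 0# ≡ δ x a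
  δ[a-x,0]≡δ[x,a] a x with (a ⊖ x) ≈? 0# | x ≈? a
  ... | yes _     | yes _   = refl
  ... | no _      | no _    = refl
  ... | yes a-x≈0 | no x≉a  = contradiction (≈-sym (x∙y⁻¹≈ε⇒x≈y a x a-x≈0)) x≉a
  ... | no a-x≉0  | yes x≈a = contradiction (x≈y⇒x∙y⁻¹≈ε (≈-sym x≈a)) a-x≉0

  sumF-δ : ∀ c → sumF F (λ x → δ x c) ≡ 1ℚ
  sumF-δ c with enum-surj c
  ... | j , j↦c = trans (sumFin-single size j _ off-diagonal) diagonal
    where
    off-diagonal : ∀ i → i ≢ j → δ (enum i) c ≡ 0ℚ
    off-diagonal i i≢j with enum i ≈? c
    ... | yes i↦c = contradiction (enum-inj i j (≈-trans i↦c (≈-sym j↦c))) i≢j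
    ... | no _    = refl
    diagonal : δ (enum j) c ≡ 1ℚ
    diagonal with enum j ≈? c
    ... | yes _    = refl
    ... | no j↦̸c = contradiction j↦c j↦̸c

  γ≡q⁻¹-δ : ∀ b → γ F b ≡ inv q - δ b 0#
  γ≡q⁻¹-δ b with b ≈? 0#
  ... | yes _ = refl
  ... | no _  = sym (ℚ.+-identityʳ (inv q))

  γ-sub : ∀ a x → γ F a - γ F (a ⊖ x) ≡ δ x a - δ a 0#
  γ-sub a x = begin
    γ F a - γ F (a ⊖ x)                          ≡⟨ cong₂ _-_ (γ≡q⁻¹-δ a) (γ≡q⁻¹-δ (a ⊖ x)) ⟩
    (inv q - δ a 0#) - (inv q - δ (a ⊖ x) 0#)    ≡⟨ cancel (inv q) (δ a 0#) _ ⟩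
    δ (a ⊖ x) 0# - δ a 0#                        ≡⟨ cong (_- δ a 0#) (δ[a-x,0]≡δ[x,a] a x) ⟩
    δ x a - δ a 0#                               ∎
    where
    cancel : ∀ c u v → (c - u) - (c - v) ≡ v - u
    cancel = solve-∀ ℚ-ring

  -- The term x = 0, which χ₀ kills, vanishes anyway.
  χ₀*[δ-δ] : ∀ a x → χ₀ F x * (δ x a - δ a 0#) ≡ δ x a - δ a 0#
  χ₀*[δ-δ] a x with x ≈? 0#
  ... | no _    = ℚ.*-identityˡ _
  ... | yes x≈0 = begin
    0ℚ * (δ x a - δ a 0#)   ≡⟨ ℚ.*-zeroˡ (δ x a - δ a 0#) ⟩
    0ℚ                      ≡⟨ sym (ℚ.+-inverseʳ (δ a 0#)) ⟩
    δ a 0# - δ a 0#         ≡⟨ cong (_- δ a 0#) (sym (trans (δ-congˡ a x≈0) (δ-sym 0# a))) ⟩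
    δ x a - δ a 0#          ∎

  χ₀-γ-sum : ∀ a → sumF F (λ x → χ₀ F x * (γ F a - γ F (a ⊖ x))) ≡ q * γ F a
  χ₀-γ-sum a = begin
    sumF F (λ x → χ₀ F x * (γ F a - γ F (a ⊖ x)))
      ≡⟨ sumFin-cong size (λ i → trans (cong (χ₀ F (enum i) *_) (γ-sub a (enum i))) (χ₀*[δ-δ] a (enum i))) ⟩
    sumF F (λ x → δ x a - δ a 0#)
      ≡⟨ sumFin-sub size _ _ ⟩
    sumF F (λ x → δ x a) - sumF F (λ _ → δ a 0#)
      ≡⟨ cong₂ _-_ (sumF-δ a) (sumFin-const size (δ a 0#)) ⟩
    1ℚ - q * δ a 0#
      ≡⟨ cong (_- q * δ a 0#) (sym q*q⁻¹≡1) ⟩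
    q * inv q - q * δ a 0#
      ≡⟨ factor q (inv q) (δ a 0#) ⟩
    q * (inv q - δ a 0#)
      ≡⟨ cong (q *_) (sym (γ≡q⁻¹-δ a)) ⟩
    q * γ F a
      ∎
    where
    factor : ∀ c u v → c * u - c * v ≡ c * (u - v)
    factor = solve-∀ ℚ-ring

  f-cong-⇔ : ∀ {m n} a b (u : Vec Carrier m) (v : Vec Carrier n) →
    (sumVec F u ≈ a → sumVec F v ≈ b) → (sumVec F v ≈ b → sumVec F u ≈ a) → f F a u ≡ f F b v
  f-cong-⇔ a b u v u⇒v v⇒u with sumVec F u ≈? a | sumVec F v ≈? b
  ... | yes _ | yes _ = refl
  ... | no _  | no _  = refl
  ... | yes u≈a | no v≉b = contradiction (u⇒v u≈a) v≉b
  ... | no u≉a  | yes v≈b = contradiction (v⇒u v≈b) u≉a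

  f-[] : ∀ a → f F a [] ≡ δ 0# a
  f-[] a with 0# ≈? a
  ... | yes _ = refl
  ... | no _  = refl

  f-0#∷ : ∀ a {n} (v : Vec Carrier n) → f F a (0# ∷ v) ≡ f F a v
  f-0#∷ a v = f-cong-⇔ a a (0# ∷ v) v
    (≈-trans (≈-sym (+-identityˡ _)))
    (≈-trans (+-identityˡ _))

  f-∷ : ∀ a x {n} (v : Vec Carrier n) → f F a (x ∷ v) ≡ f F (a ⊖ x) v
  f-∷ a x v = f-cong-⇔ a (a ⊖ x) (x ∷ v) v
    (λ x+s≈a → x≈z//y _ x a (≈-trans (+-comm _ x) x+s≈a))
    (λ s≈a-x → ≈-trans (+-comm x _) (≈-trans (+-congʳ s≈a-x) (//-rightDividesˡ x a)))

  möbiusSum : ∀ a {r} → Subset r → Vec Carrier r → ℚ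
  möbiusSum a {r} S v = sumSubsets r (λ T → möbius S T * f F a (restrict F T v))

  -- The summand of fS is local to its definition and cannot be named; fS-möbius
  -- determines the wildcard before fS-summand is checked.
  mutual
    fS-möbius : ∀ a {r} (S : Subset r) xs → fS F a S xs ≡ möbiusSum a S (embed F S xs)
    fS-möbius a {r} S xs = sumSubsets-cong r (fS-summand a S xs)

    fS-summand : ∀ a {r} (S : Subset r) xs T → _ ≡ möbius S T * f F a (restrict F T (embed F S xs))
    fS-summand a S xs T with T ⊆? S
    ... | yes T⊆S = cong (_* fₜ) (sym (möbius-⊆ T⊆S))
      where fₜ = f F a (restrict F T (embed F S xs))
    ... | no T⊈S  = sym (trans (cong (_* fₜ) (möbius-⊈ T⊈S)) (ℚ.*-zeroˡ fₜ))
      where fₜ = f F a (restrict F T (embed F S xs))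

  möbiusSum-outside : ∀ a {r} (S : Subset r) y v → möbiusSum a (outside ∷ S) (y ∷ v) ≡ möbiusSum a S v
  möbiusSum-outside a {r} S y v = begin
    sumSubsets r (λ T → 0ℚ * f F a (y ∷ restrict F T v))
      + sumSubsets r (λ T → möbius S T * f F a (0# ∷ restrict F T v))
      ≡⟨ cong₂ _+_ (sumSubsets-zero r _ (λ T → ℚ.*-zeroˡ (f F a (y ∷ restrict F T v))))
                   (sumSubsets-cong r (λ T → cong (möbius S T *_) (f-0#∷ a (restrict F T v)))) ⟩
    0ℚ + möbiusSum a S v
      ≡⟨ ℚ.+-identityˡ _ ⟩
    möbiusSum a S v
      ∎

  möbiusSum-inside : ∀ a x {r} (S : Subset r) v →
    möbiusSum a (inside ∷ S) (x ∷ v) ≡ möbiusSum (a ⊖ x) S v - möbiusSum a S v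
  möbiusSum-inside a x {r} S v = begin
    sumSubsets r (λ T → möbius S T * f F a (x ∷ restrict F T v))
      + sumSubsets r (λ T → - möbius S T * f F a (0# ∷ restrict F T v))
      ≡⟨ cong₂ _+_ (sumSubsets-cong r (λ T → cong (möbius S T *_) (f-∷ a x (restrict F T v))))
                   (sumSubsets-cong r (λ T → trans (cong (- möbius S T *_) (f-0#∷ a (restrict F T v)))
                                                   (sym (ℚ.neg-distribˡ-* (möbius S T) (f F a (restrict F T v)))))) ⟩
    möbiusSum (a ⊖ x) S v + sumSubsets r (λ T → - (möbius S T * f F a (restrict F T v)))
      ≡⟨ cong (möbiusSum (a ⊖ x) S v +_) (sumSubsets-neg r _) ⟩
    möbiusSum (a ⊖ x) S v - möbiusSum a S v
      ∎

  fS-outside : ∀ a {r} (S : Subset r) xs → fS F a (outside ∷ S) xs ≡ fS F a S xs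
  fS-outside a S xs = begin
    fS F a (outside ∷ S) xs                       ≡⟨ fS-möbius a (outside ∷ S) xs ⟩
    möbiusSum a (outside ∷ S) (0# ∷ embed F S xs)  ≡⟨ möbiusSum-outside a S 0# (embed F S xs) ⟩
    möbiusSum a S (embed F S xs)                  ≡⟨ fS-möbius a S xs ⟨
    fS F a S xs                                   ∎

  fS-inside : ∀ a x {r} (S : Subset r) xs → fS F a (inside ∷ S) (x ∷ xs) ≡ fS F (a ⊖ x) S xs - fS F a S xs
  fS-inside a x S xs = begin
    fS F a (inside ∷ S) (x ∷ xs)                                   ≡⟨ fS-möbius a (inside ∷ S) (x ∷ xs) ⟩
    möbiusSum a (inside ∷ S) (x ∷ embed F S xs)                    ≡⟨ möbiusSum-inside a x S (embed F S xs) ⟩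
    möbiusSum (a ⊖ x) S (embed F S xs) - möbiusSum a S (embed F S xs)
      ≡⟨ cong₂ _-_ (fS-möbius (a ⊖ x) S xs) (fS-möbius a S xs) ⟨
    fS F (a ⊖ x) S xs - fS F a S xs                                ∎

  χ₀-sum-fS : ∀ {r} (S : Subset r) a → χ₀-sum ∣ S ∣ (fS F a S) ≡ 𝟙[ S ≡∅] * inv q - γ F a * (- q) ^ ∣ S ∣
  χ₀-sum-fS [] a = begin
    fS F a [] [] * 1ℚ                      ≡⟨ ℚ.*-identityʳ _ ⟩
    1ℚ * f F a []                          ≡⟨ ℚ.*-identityˡ _ ⟩
    f F a []                               ≡⟨ trans (f-[] a) (δ-sym 0# a) ⟩
    δ a 0#                                 ≡⟨ δ≡q⁻¹-[q⁻¹-δ] (inv q) (δ a 0#) ⟩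
    1ℚ * inv q - (inv q - δ a 0#) * 1ℚ     ≡⟨ cong (λ z → 1ℚ * inv q - z * 1ℚ) (sym (γ≡q⁻¹-δ a)) ⟩
    1ℚ * inv q - γ F a * 1ℚ                ∎
    where
    δ≡q⁻¹-[q⁻¹-δ] : ∀ u w → w ≡ 1ℚ * u - (u - w) * 1ℚ
    δ≡q⁻¹-[q⁻¹-δ] = solve-∀ ℚ-ring
  χ₀-sum-fS (outside ∷ S) a = begin
    χ₀-sum n (fS F a (outside ∷ S))                  ≡⟨ χ₀-sum-cong n (fS-outside a S) ⟩
    χ₀-sum n (fS F a S)                              ≡⟨ χ₀-sum-fS S a ⟩
    𝟙[ S ≡∅] * inv q - γ F a * (- q) ^ n
      ≡⟨ cong (λ z → z * inv q - γ F a * (- q) ^ n) (sym (𝟙[outside∷S≡∅] S)) ⟩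
    𝟙[ outside ∷ S ≡∅] * inv q - γ F a * (- q) ^ n   ∎
    where n = ∣ S ∣
  χ₀-sum-fS (inside ∷ S) a = begin
    χ₀-sum (ℕ.suc n) (fS F a (inside ∷ S))
      ≡⟨ χ₀-sum-suc n (fS F a (inside ∷ S)) ⟩
    sumF F (λ x → χ₀ F x * χ₀-sum n (λ xs → fS F a (inside ∷ S) (x ∷ xs)))
      ≡⟨ sumFin-cong size (λ i → trans (cong (χ₀ F (enum i) *_) (slice (enum i))) (swap (χ₀ F (enum i)) _ P)) ⟩
    sumF F (λ x → P * (χ₀ F x * (γ F a - γ F (a ⊖ x))))
      ≡⟨ sumFin-*ˡ size P _ ⟩
    P * sumF F (λ x → χ₀ F x * (γ F a - γ F (a ⊖ x)))
      ≡⟨ cong (P *_) (χ₀-γ-sum a) ⟩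
    P * (q * γ F a)
      ≡⟨ regroup P q (inv q) (γ F a) ⟩
    0ℚ * inv q - γ F a * (- q * P)
      ∎
    where
    n = ∣ S ∣
    P = (- q) ^ n
    cancel : ∀ e g g′ p → (e - g′ * p) - (e - g * p) ≡ (g - g′) * p
    cancel = solve-∀ ℚ-ring
    swap : ∀ c d p → c * (d * p) ≡ p * (c * d)
    swap = solve-∀ ℚ-ring
    regroup : ∀ p c u g → p * (c * g) ≡ 0ℚ * u - g * (- c * p)
    regroup = solve-∀ ℚ-ring
    slice : ∀ x → χ₀-sum n (λ xs → fS F a (inside ∷ S) (x ∷ xs)) ≡ (γ F a - γ F (a ⊖ x)) * P
    slice x = begin
      χ₀-sum n (λ xs → fS F a (inside ∷ S) (x ∷ xs))         ≡⟨ χ₀-sum-cong n (fS-inside a x S) ⟩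
      χ₀-sum n (λ xs → fS F (a ⊖ x) S xs - fS F a S xs)      ≡⟨ χ₀-sum-sub n (fS F (a ⊖ x) S) (fS F a S) ⟩
      χ₀-sum n (fS F (a ⊖ x) S) - χ₀-sum n (fS F a S)        ≡⟨ cong₂ _-_ (χ₀-sum-fS S (a ⊖ x)) (χ₀-sum-fS S a) ⟩
      (𝟙[ S ≡∅] * inv q - γ F (a ⊖ x) * P) - (𝟙[ S ≡∅] * inv q - γ F a * P)
        ≡⟨ cancel (𝟙[ S ≡∅] * inv q) (γ F a) (γ F (a ⊖ x)) P ⟩
      (γ F a - γ F (a ⊖ x)) * P                              ∎

  hatAtTrivial-fS : ∀ {r} (S : Subset r) a →
    hatAtTrivial F ∣ S ∣ (fS F a S) ≡ 𝟙[ S ≡∅] * inv q - γ F a * inv ((inv q - 1ℚ) ^ ∣ S ∣)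
  hatAtTrivial-fS S a = begin
    c n * χ₀-sum n (fS F a S)                      ≡⟨ cong (c n *_) (χ₀-sum-fS S a) ⟩
    c n * (𝟙[ S ≡∅] * inv q - γ F a * (- q) ^ n)   ≡⟨ distribute (c n) 𝟙[ S ≡∅] (inv q) (γ F a) ((- q) ^ n) ⟩
    𝟙[ S ≡∅] * c n * inv q - γ F a * (c n * (- q) ^ n)
      ≡⟨ cong₂ (λ y z → y * inv q - γ F a * z) (𝟙[S≡∅]*g∣S∣ S c refl) (inv[x-1]^n*[-x]^n q n q≢0 q-1≢0) ⟩
    𝟙[ S ≡∅] * inv q - γ F a * inv ((inv q - 1ℚ) ^ n)   ∎
    where
    n = ∣ S ∣
    c : ℕ → ℚ
    c k = inv ((q - 1ℚ) ^ k)
    distribute : ∀ c e u g p → c * (e * u - g * p) ≡ e * c * u - g * (c * p)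
    distribute = solve-∀ ℚ-ring

lemma3p5 : (F : FiniteField) (r : ℕ) → 0 < r → (a : FiniteField.Carrier F) (S : Subset r) →
    hatAtTrivial F ∣ S ∣ (fS F a S)
      ≡ (𝟙[ S ≡∅] * inv (qℚ F)) - (γ F a * inv ((inv (qℚ F) - 1ℚ) ^ ∣ S ∣))
lemma3p5 F r _ a S = hatAtTrivial-fS F S a
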